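{- Let $f:2^U\to\mathbb{R}$ be monotone submodular, $U$ partitioned into $U_1,\dots,U_N$, $k_1,\dots,k_N$ positive integers with $k_j\le|U_j|$, $\phi=\lfloor\sqrt{\min_{i\in[N]}k_i}\rfloor-1\ge1$, $r_j=\lfloor k_j/\phi\rfloor$. Let $\mathcal{P}'=\{S\subseteq U:|S\cap U_j|\le r_j\phi\ \forall j\in[N]\}$ and $OPT'\in\arg\max_{S\in\mathcal{P}'}f(S)$. Fix $j\in[N]$ and let Greedy-Subroutine-Mono (described in the context) be run on partition $U_j$ with input set $S$, producing output $S'$. Then $f(S')-f(S)\ge\frac{\Delta f(S',OPT_j)}{\phi}$, where $OPT_j=OPT'\cap U_j$.
   Context: $f$ submodular: $f(A\cup\{x\})-f(A)\ge f(B\cup\{x\})-f(B)$ for $A\subseteq B\subseteq U$, $x\notin B$; monotone: $f(X)\le f(Y)$ for $X\subseteq Y$; $\Delta f(S,x)=f(S\cup\{x\})-f(S)$, $\Delta f(S,T)=f(S\cup T)-f(S)$. Greedy-Subroutine-Mono on partition $U_j$ with input $S$: repeat $r_j$ times: $S\gets S\cup\{\arg\max_{x\in U_j}\Delta f(S,x)\}$; the resulting set is the output $S'$. -}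

module Defs where

open import Level using (Level; _⊔_)
open import Data.Nat as ℕ using (ℕ; zero; suc; _≟_)
open import Data.Fin using (Fin)
open import Data.Fin.Subset using (Subset; _∪_; ⁅_⁆; _∈_)
open import Data.Vec using (tabulate)
open import Data.Product using (Σ; _×_)
open import Data.Sum using (_⊎_)
open import Relation.Nullary.Decidable using (⌊_⌋)
open import Relation.Binary.PropositionalEquality using (_≡_)
open import Algebra.Bundles using (AbelianGroup)

-- A totally ordered abelian group (e.g. (ℝ, +, ≤)); the value domain of f.
-- Stated generally since Agda's stdlib has no real numbers.
record OrderedAbelianGroup (c ℓ₁ ℓ₂ : Level) : Set (Level.suc (c ⊔ ℓ₁ ⊔ ℓ₂)) where
  field
    abelianGroup : AbelianGroup c ℓ₁
  open AbelianGroup abelianGroup public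
  field
    _≤_       : Carrier → Carrier → Set ℓ₂
    ≤-resp-≈  : ∀ {x x′ y y′} → x ≈ x′ → y ≈ y′ → x ≤ y → x′ ≤ y′
    ≤-refl    : ∀ {x} → x ≤ x
    ≤-trans   : ∀ {x y z} → x ≤ y → y ≤ z → x ≤ z
    ≤-antisym : ∀ {x y} → x ≤ y → y ≤ x → x ≈ y
    ≤-total   : ∀ x y → (x ≤ y) ⊎ (y ≤ x)
    ∙-monoˡ-≤ : ∀ {x y} z → x ≤ y → (x ∙ z) ≤ (y ∙ z)

  _×ₙ_ : ℕ → Carrier → Carrier
  zero  ×ₙ x = ε
  suc m ×ₙ x = x ∙ (m ×ₙ x)

module _ {c ℓ₁ ℓ₂} (G : OrderedAbelianGroup c ℓ₁ ℓ₂) {n : ℕ} where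
  open OrderedAbelianGroup G

  Monotone : (Subset n → Carrier) → Set ℓ₂
  Monotone f = ∀ {X Y} → X Data.Fin.Subset.⊆ Y → f X ≤ f Y

  Δₑ : (Subset n → Carrier) → Subset n → Fin n → Carrier
  Δₑ f S x = f (S ∪ ⁅ x ⁆) - f S

  Δₛ : (Subset n → Carrier) → Subset n → Subset n → Carrier
  Δₛ f S T = f (S ∪ T) - f S

  Submodular : (Subset n → Carrier) → Set ℓ₂
  Submodular f = ∀ {A B x} → A Data.Fin.Subset.⊆ B → x Data.Fin.Subset.∉ B →
                 Δₑ f B x ≤ Δₑ f A x

  GreedyStep : (Subset n → Carrier) → Subset n → Subset n → Subset n → Set ℓ₂
  GreedyStep f Uⱼ S S′ =
    Σ (Fin n) λ x → x ∈ Uⱼ × (∀ y → y ∈ Uⱼ → Δₑ f S y ≤ Δₑ f S x) × (S′ ≡ S ∪ ⁅ x ⁆)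

  -- GreedyRun f Uⱼ t S S' : S' is an output of t greedy steps from S on Uⱼ
  -- (Greedy-Subroutine-Mono with t = rⱼ).
  data GreedyRun (f : Subset n → Carrier) (Uⱼ : Subset n) :
       ℕ → Subset n → Subset n → Set ℓ₂ where
    done : ∀ {S} → GreedyRun f Uⱼ zero S S
    step : ∀ {t S S₁ S′} → GreedyStep f Uⱼ S S₁ → GreedyRun f Uⱼ t S₁ S′ →
           GreedyRun f Uⱼ (suc t) S S′

-- the block U_j = {x | part x = j} of the partition given by part : U → [N]
block : ∀ {n N} → (Fin n → Fin N) → Fin N → Subset n
block part j = tabulate (λ x → ⌊ part x Data.Fin.≟ j ⌋)

IsMinimum : ∀ {N} → (Fin N → ℕ) → ℕ → Set
IsMinimum {N} k m = (∀ i → m ℕ.≤ k i) × Σ (Fin N) (λ i → k i ≡ m)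

IsFloorSqrt : ℕ → ℕ → Set
IsFloorSqrt m s = (s ℕ.* s ℕ.≤ m) × (m ℕ.< suc s ℕ.* suc s)

{-# OPTIONS --safe #-}
-- Let S = S₀ ⊂ S₁ ⊂ … ⊂ S_r = S′ be the greedy run, gₜ = f(Sₜ₊₁) − f(Sₜ) its gains.
-- By submodularity, Δf(S′, T) ≤ Σ_{y ∈ T} Δf(Sₜ, y) ≤ |T| gₜ for every step t and every
-- T ⊆ Uⱼ, since the greedy choice maximises the marginal gain over Uⱼ. Summing over the
-- r steps, the gains telescope: r Δf(S′, T) ≤ |T| (f(S′) − f(S)). For T = OPTⱼ we have
-- |T| ≤ rⱼ φ, and rⱼ ≥ 1 because φ ≤ ⌊√m⌋ ≤ m ≤ kⱼ, so rⱼ can be cancelled.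
module Submission where

open import Defs
open import Level using (Level)
open import Data.Nat as ℕ using (ℕ; _∸_; _/_; _*_; >-nonZero)
open import Data.Fin using (Fin)
open import Data.Fin.Subset using (Subset; _∩_; ∣_∣)
open import Relation.Binary.PropositionalEquality using (_≡_)

import Algebra.Properties.CommutativeMonoid.Mult as CommutativeMonoidMult
open import Data.Bool.Properties using (∨-identityʳ)
open import Data.Fin using (zero; suc)
open import Data.Fin.Subset using (_∪_; ⁅_⁆; ⋃; _∈_; _⊆_; outside; inside)
open import Data.Fin.Subset.Properties
  using (_∈?_; ∪-identityˡ; ∪-identityʳ; ∪-assoc; p⊆p∪q; p∩q⊆q; ⊆-refl; ⊆-trans)
open import Data.List.Base using (List; []; _∷_; length; map)
open import Data.List.Properties using (length-map)
open import Data.List.Relation.Unary.All as All using (All; []; _∷_)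
open import Data.List.Relation.Unary.All.Properties using (map⁺)
import Data.Nat.Properties as ℕₚ
open import Data.Nat.DivMod using (m≥n⇒m/n>0)
open import Data.Product using (_,_)
open import Data.Sum using (inj₁; inj₂)
open import Data.Vec.Base using (_∷_; []; here; there)
open import Relation.Binary.Bundles using (Preorder)
open import Relation.Nullary using (yes; no)
open import Relation.Binary.PropositionalEquality using (refl; sym; trans; cong; cong₂)
import Relation.Binary.Reasoning.Preorder as PreorderReasoning

⌊√m⌋≤m : ∀ {m s} → IsFloorSqrt m s → s ℕ.≤ m
⌊√m⌋≤m {s = ℕ.zero}  _          = ℕ.z≤n
⌊√m⌋≤m {s = ℕ.suc s} (s²≤m , _) = ℕₚ.≤-trans (ℕₚ.m≤m*n (ℕ.suc s) (ℕ.suc s)) s²≤m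

x∈p⇒p∪⁅x⁆≡p : ∀ {n} {x : Fin n} {p : Subset n} → x ∈ p → p ∪ ⁅ x ⁆ ≡ p
x∈p⇒p∪⁅x⁆≡p {p = inside ∷ p} here        = cong (inside ∷_) (∪-identityʳ p)
x∈p⇒p∪⁅x⁆≡p {p = s ∷ p}      (there x∈p) = cong₂ _∷_ (∨-identityʳ s) (x∈p⇒p∪⁅x⁆≡p x∈p)

elements : ∀ {n} → Subset n → List (Fin n)
elements []            = []
elements (outside ∷ p) = map suc (elements p)
elements (inside ∷ p)  = zero ∷ map suc (elements p)

⋃⁅suc⁆ : ∀ {n} (xs : List (Fin n)) → ⋃ (map ⁅_⁆ (map suc xs)) ≡ outside ∷ ⋃ (map ⁅_⁆ xs)
⋃⁅suc⁆ []       = refl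
⋃⁅suc⁆ (x ∷ xs) = cong (⁅ suc x ⁆ ∪_) (⋃⁅suc⁆ xs)

⋃⁅elements⁆ : ∀ {n} (p : Subset n) → ⋃ (map ⁅_⁆ (elements p)) ≡ p
⋃⁅elements⁆ []            = refl
⋃⁅elements⁆ (outside ∷ p) = trans (⋃⁅suc⁆ (elements p)) (cong (outside ∷_) (⋃⁅elements⁆ p))
⋃⁅elements⁆ (inside ∷ p)  = trans (cong (⁅ zero ⁆ ∪_) (⋃⁅suc⁆ (elements p)))
                                  (cong (inside ∷_) (trans (∪-identityˡ _) (⋃⁅elements⁆ p)))

length-elements : ∀ {n} (p : Subset n) → length (elements p) ≡ ∣ p ∣
length-elements []            = refl
length-elements (outside ∷ p) = trans (length-map suc (elements p)) (length-elements p)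
length-elements (inside ∷ p)  = cong ℕ.suc (trans (length-map suc (elements p)) (length-elements p))

elements⊆ : ∀ {n} (p : Subset n) → All (_∈ p) (elements p)
elements⊆ []            = []
elements⊆ (outside ∷ p) = map⁺ (All.map there (elements⊆ p))
elements⊆ (inside ∷ p)  = here ∷ map⁺ (All.map there (elements⊆ p))

module OrderedAbelianGroupProperties {c ℓ₁ ℓ₂} (G : OrderedAbelianGroup c ℓ₁ ℓ₂) where
  open OrderedAbelianGroup G renaming (refl to ≈-refl; sym to ≈-sym; trans to ≈-trans)

  open CommutativeMonoidMult commutativeMonoid public
    using (_×_; ×-congʳ; ×-assocˡ; ×-distrib-+)

  ≤-reflexive : ∀ {x y} → x ≈ y → x ≤ y
  ≤-reflexive x≈y = ≤-resp-≈ ≈-refl x≈y ≤-refl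

  preorder : Preorder c ℓ₁ ℓ₂
  preorder = record
    { isPreorder = record { isEquivalence = isEquivalence ; reflexive = ≤-reflexive ; trans = ≤-trans } }

  module ≤-Reasoning = PreorderReasoning preorder

  ∙-monoʳ-≤ : ∀ {x y} z → x ≤ y → (z ∙ x) ≤ (z ∙ y)
  ∙-monoʳ-≤ {x} {y} z x≤y = ≤-resp-≈ (comm x z) (comm y z) (∙-monoˡ-≤ z x≤y)

  ∙-mono-≤ : ∀ {x y u v} → x ≤ y → u ≤ v → (x ∙ u) ≤ (y ∙ v)
  ∙-mono-≤ {y = y} {u} x≤y u≤v = ≤-trans (∙-monoˡ-≤ u x≤y) (∙-monoʳ-≤ y u≤v)

  ∙-cancelʳ-≤ : ∀ {x y} z → (x ∙ z) ≤ (y ∙ z) → x ≤ y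
  ∙-cancelʳ-≤ {x} {y} z xz≤yz = ≤-resp-≈ (cancel x) (cancel y) (∙-monoˡ-≤ (z ⁻¹) xz≤yz)
    where
    cancel : ∀ w → (w ∙ z) ∙ z ⁻¹ ≈ w
    cancel w = ≈-trans (assoc w z (z ⁻¹)) (≈-trans (∙-cong ≈-refl (inverseʳ z)) (identityʳ w))

  x≤y⇒ε≤y-x : ∀ {x y} → x ≤ y → ε ≤ (y - x)
  x≤y⇒ε≤y-x {x} x≤y = ≤-resp-≈ (inverseʳ x) ≈-refl (∙-monoˡ-≤ (x ⁻¹) x≤y)

  telescope : ∀ x y z → (x - y) ∙ (y - z) ≈ x - z
  telescope x y z = begin-equality
    (x ∙ y ⁻¹) ∙ (y ∙ z ⁻¹)  ≈⟨ assoc x (y ⁻¹) (y ∙ z ⁻¹) ⟩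
    x ∙ (y ⁻¹ ∙ (y ∙ z ⁻¹))  ≈⟨ ∙-cong ≈-refl (≈-sym (assoc (y ⁻¹) y (z ⁻¹))) ⟩
    x ∙ ((y ⁻¹ ∙ y) ∙ z ⁻¹)  ≈⟨ ∙-cong ≈-refl (∙-cong (inverseˡ y) ≈-refl) ⟩
    x ∙ (ε ∙ z ⁻¹)           ≈⟨ ∙-cong ≈-refl (identityˡ (z ⁻¹)) ⟩
    x ∙ z ⁻¹                 ∎
    where open ≤-Reasoning

  ×ₙ≡× : ∀ m x → m ×ₙ x ≡ m × x
  ×ₙ≡× ℕ.zero    x = refl
  ×ₙ≡× (ℕ.suc m) x = cong (x ∙_) (×ₙ≡× m x)

  ×-monoʳ-≤ : ∀ m {x y} → x ≤ y → (m × x) ≤ (m × y)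
  ×-monoʳ-≤ ℕ.zero    x≤y = ≤-refl
  ×-monoʳ-≤ (ℕ.suc m) x≤y = ∙-mono-≤ x≤y (×-monoʳ-≤ m x≤y)

  ε≤x⇒ε≤m×x : ∀ m {x} → ε ≤ x → ε ≤ (m × x)
  ε≤x⇒ε≤m×x ℕ.zero    ε≤x = ≤-refl
  ε≤x⇒ε≤m×x (ℕ.suc m) ε≤x = ≤-resp-≈ (identityˡ ε) ≈-refl (∙-mono-≤ ε≤x (ε≤x⇒ε≤m×x m ε≤x))

  ×-monoˡ-≤ : ∀ {x} → ε ≤ x → ∀ {m n} → m ℕ.≤ n → (m × x) ≤ (n × x)
  ×-monoˡ-≤ ε≤x {n = n} ℕ.z≤n     = ε≤x⇒ε≤m×x n ε≤x
  ×-monoˡ-≤ {x} ε≤x     (ℕ.s≤s m≤n) = ∙-monoʳ-≤ x (×-monoˡ-≤ ε≤x m≤n)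

  ×-cancelˡ-≤ : ∀ {m x y} → 0 ℕ.< m → (m × x) ≤ (m × y) → x ≤ y
  ×-cancelˡ-≤ {ℕ.suc m} {x} {y} _ mx≤my with ≤-total x y
  ... | inj₁ x≤y = x≤y
  ... | inj₂ y≤x = ∙-cancelʳ-≤ (m × x) (≤-trans mx≤my (∙-monoʳ-≤ y (×-monoʳ-≤ m y≤x)))

module SubmodularProperties
  {c ℓ₁ ℓ₂} (G : OrderedAbelianGroup c ℓ₁ ℓ₂) {n : ℕ}
  {f : Subset n → OrderedAbelianGroup.Carrier G}
  (mono : Monotone G f) (submod : Submodular G f) where

  open OrderedAbelianGroup G renaming (refl to ≈-refl; sym to ≈-sym; trans to ≈-trans)
  open OrderedAbelianGroupProperties G
  open ≤-Reasoning

  -- Submodular only covers y ∉ B; for y ∈ B the left side vanishes and monotonicity suffices.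
  Δₑ-antitone : ∀ {A B} y → A ⊆ B → Δₑ G f B y ≤ Δₑ G f A y
  Δₑ-antitone {A} {B} y A⊆B with y ∈? B
  ... | no  y∉B = submod A⊆B y∉B
  ... | yes y∈B = begin
    f (B ∪ ⁅ y ⁆) - f B  ≡⟨ cong (λ X → f X - f B) (x∈p⇒p∪⁅x⁆≡p y∈B) ⟩
    f B - f B            ≈⟨ inverseʳ (f B) ⟩
    ε                    ≲⟨ x≤y⇒ε≤y-x (mono (p⊆p∪q ⁅ y ⁆)) ⟩
    Δₑ G f A y           ∎

  Δₛ⋃≤length×g : ∀ {A B g} → A ⊆ B → (ys : List (Fin n)) → All (λ y → Δₑ G f A y ≤ g) ys →
                Δₛ G f B (⋃ (map ⁅_⁆ ys)) ≤ (length ys × g)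
  Δₛ⋃≤length×g {B = B} A⊆B [] [] = begin
    f (B ∪ ⋃ []) - f B  ≡⟨ cong (λ X → f X - f B) (∪-identityʳ B) ⟩
    f B - f B           ≈⟨ inverseʳ (f B) ⟩
    ε                   ∎
  Δₛ⋃≤length×g {A} {B} {g} A⊆B (y ∷ ys) (Δy≤g ∷ Δys≤g) = begin
    f (B ∪ (⁅ y ⁆ ∪ Y)) - f B          ≡⟨ cong (λ X → f X - f B) (sym (∪-assoc B ⁅ y ⁆ Y)) ⟩
    f (B′ ∪ Y) - f B                   ≈⟨ ≈-sym (telescope _ _ _) ⟩
    Δₛ G f B′ Y ∙ Δₑ G f B y           ≈⟨ comm _ _ ⟩
    Δₑ G f B y ∙ Δₛ G f B′ Y           ≲⟨ ∙-mono-≤ (≤-trans (Δₑ-antitone y A⊆B) Δy≤g)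
                                                   (Δₛ⋃≤length×g (⊆-trans A⊆B (p⊆p∪q ⁅ y ⁆)) ys Δys≤g) ⟩
    g ∙ length ys × g                  ∎
    where
    B′ = B ∪ ⁅ y ⁆
    Y  = ⋃ (map ⁅_⁆ ys)

  Δₛ≤∣T∣×g : ∀ {A B T g} → A ⊆ B → (∀ {y} → y ∈ T → Δₑ G f A y ≤ g) → Δₛ G f B T ≤ (∣ T ∣ × g)
  Δₛ≤∣T∣×g {A} {B} {T} {g} A⊆B bound = begin
    Δₛ G f B T                            ≡⟨ cong (Δₛ G f B) (sym (⋃⁅elements⁆ T)) ⟩
    Δₛ G f B (⋃ (map ⁅_⁆ (elements T)))  ≲⟨ Δₛ⋃≤length×g A⊆B (elements T) (All.map bound (elements⊆ T)) ⟩
    length (elements T) × g              ≡⟨ cong (_× g) (length-elements T) ⟩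
    ∣ T ∣ × g                            ∎

  greedyRun-⊆ : ∀ {U t S S′} → GreedyRun G f U t S S′ → S ⊆ S′
  greedyRun-⊆ done                            = ⊆-refl
  greedyRun-⊆ (step (x , _ , _ , refl) run) = ⊆-trans (p⊆p∪q ⁅ x ⁆) (greedyRun-⊆ run)

  greedyRun-gain : ∀ {U T t S S′} → T ⊆ U → GreedyRun G f U t S S′ →
                   (t × Δₛ G f S′ T) ≤ (∣ T ∣ × (f S′ - f S))
  greedyRun-gain {T = T} {S′ = S′} T⊆U done =
    ε≤x⇒ε≤m×x ∣ T ∣ (≤-reflexive (≈-sym (inverseʳ (f S′))))
  greedyRun-gain {T = T} {S = S} {S′} T⊆U
                 run@(step {t = t} {S₁ = S₁} (x , _ , x-max , refl) rest) = begin
    Δₛ G f S′ T ∙ t × Δₛ G f S′ T                 ≲⟨ ∙-mono-≤ step-gain (greedyRun-gain T⊆U rest) ⟩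
    ∣ T ∣ × (f S₁ - f S) ∙ ∣ T ∣ × (f S′ - f S₁)  ≈⟨ ≈-sym (×-distrib-+ _ _ ∣ T ∣) ⟩
    ∣ T ∣ × ((f S₁ - f S) ∙ (f S′ - f S₁))        ≈⟨ ×-congʳ ∣ T ∣ (≈-trans (comm _ _) (telescope _ _ _)) ⟩
    ∣ T ∣ × (f S′ - f S)                          ∎
    where
    step-gain : Δₛ G f S′ T ≤ (∣ T ∣ × Δₑ G f S x)
    step-gain = Δₛ≤∣T∣×g (greedyRun-⊆ run) (λ y∈T → x-max _ (T⊆U y∈T))

  greedyRun-guarantee : ∀ {U T t φ S S′} → 0 ℕ.< t → T ⊆ U → ∣ T ∣ ℕ.≤ t * φ →
                        GreedyRun G f U t S S′ → Δₛ G f S′ T ≤ (φ × (f S′ - f S))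
  greedyRun-guarantee {T = T} {t} {φ} {S} {S′} t>0 T⊆U ∣T∣≤tφ run = ×-cancelˡ-≤ t>0 (begin
    t × Δₛ G f S′ T         ≲⟨ greedyRun-gain T⊆U run ⟩
    ∣ T ∣ × (f S′ - f S)    ≲⟨ ×-monoˡ-≤ (x≤y⇒ε≤y-x (mono (greedyRun-⊆ run))) ∣T∣≤tφ ⟩
    (t * φ) × (f S′ - f S)  ≈⟨ ≈-sym (×-assocˡ _ t φ) ⟩
    t × (φ × (f S′ - f S))  ∎)

lemma4 : ∀ {c ℓ₁ ℓ₂} (G : OrderedAbelianGroup c ℓ₁ ℓ₂) →
    let open OrderedAbelianGroup G in
    (n N : ℕ) (f : Subset n → Carrier) →
    Monotone G f → Submodular G f →
    (part : Fin n → Fin N) →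
    (k : Fin N → ℕ) → (∀ i → 1 ℕ.≤ k i) → (∀ i → k i ℕ.≤ ∣ block part i ∣) →
    (m s φ : ℕ) → IsMinimum k m → IsFloorSqrt m s → φ ≡ s ∸ 1 →
    (φ≥1 : 1 ℕ.≤ φ) →
    let r : Fin N → ℕ
        r i = (k i / φ) {{>-nonZero φ≥1}}
    in
    (OPT′ : Subset n) →
    (∀ i → ∣ OPT′ ∩ block part i ∣ ℕ.≤ r i * φ) →
    (∀ T → (∀ i → ∣ T ∩ block part i ∣ ℕ.≤ r i * φ) → f T ≤ f OPT′) →
    (j : Fin N) (S S′ : Subset n) →
    GreedyRun G f (block part j) (r j) S S′ →
    Δₛ G f S′ (OPT′ ∩ block part j) ≤ (φ ×ₙ (f S′ - f S))
lemma4 G n N f mono submod part k _ _ m s φ (m≤k , _) s-isFloorSqrt refl φ≥1 OPT′ OPT′-feasible _ j S S′ run =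
  begin
    Δₛ G f S′ (OPT′ ∩ block part j)  ≲⟨ greedyRun-guarantee rⱼ>0 (p∩q⊆q OPT′ (block part j)) (OPT′-feasible j) run ⟩
    φ × (f S′ - f S)                 ≡⟨ ×ₙ≡× φ _ ⟨
    φ ×ₙ (f S′ - f S)                ∎
  where
  open OrderedAbelianGroup G hiding (refl; sym; trans)
  open OrderedAbelianGroupProperties G
  open SubmodularProperties G mono submod
  open ≤-Reasoning

  φ≤kⱼ : φ ℕ.≤ k j
  φ≤kⱼ = ℕₚ.≤-trans (ℕₚ.m∸n≤m s 1) (ℕₚ.≤-trans (⌊√m⌋≤m s-isFloorSqrt) (m≤k j))

  rⱼ>0 : 0 ℕ.< (k j / φ) {{>-nonZero φ≥1}}
  rⱼ>0 = m≥n⇒m/n>0 {{>-nonZero φ≥1}} φ≤kⱼ
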